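{- For every vertex $v\in V$, $X_v=\hat T_v$.
   Context: $G=(V,E,w)$ is an undirected graph with nonnegative weights and fixed root $r$. Cuts are identified with the side $X$ not containing $r$; a mincut is a cut of minimum weight. The minimal mincut $X_v$ of $v\neq r$ is the least-size mincut containing $v$; set $X_r=V$. Assume every non-root vertex has a minimal mincut and these minimal mincuts are pairwise distinct. The nesting relation tree $\hat T$ has vertex set $V$, root $r$, and the parent of $v\neq r$ is the unique vertex $p_v$ with $X_v\subsetneq X_{p_v}$ such that no vertex $u$ satisfies $X_v\subsetneq X_u\subsetneq X_{p_v}$. $\hat T_v$ denotes the set of vertices in the subtree of $\hat T$ rooted at $v$.
   Formalization: The edge weights of G take values in the nonnegative rationals. -}

module Defs where

open import Data.Nat using (ℕ; _≤_)
open import Data.Bool using (Bool; true; false; _∧_; not; if_then_else_)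
open import Data.Fin using (Fin)
open import Data.Fin.Subset using (Subset; _∈_; _∉_; _⊂_; ∣_∣; Nonempty)
open import Data.List using (List; foldr; map)
open import Data.List.Base using (allFin)
open import Data.Vec using (lookup)
open import Data.Rational using (ℚ; 0ℚ; _+_) renaming (_≤_ to _≤ℚ_)
open import Data.Product using (_×_; ∃)
open import Relation.Binary.PropositionalEquality using (_≡_)
open import Relation.Nullary using (¬_)

-- A weighted undirected graph on vertex set Fin n: a symmetric weight
-- function with nonnegative (rational) weights; weight 0 = no edge.
record WGraph (n : ℕ) : Set where
  field
    w     : Fin n → Fin n → ℚ
    w-sym : ∀ u v → w u v ≡ w v u
    w-nonneg : ∀ u v → 0ℚ ≤ℚ w u v
open WGraph public

sumℚ : List ℚ → ℚ
sumℚ = foldr _+_ 0ℚ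

-- weight of the cut X : total weight of edges with exactly one end in X
-- (each edge {u,v} with u ∈ X, v ∉ X counted once, as the pair (u , v)).
cutWeight : ∀ {n} → WGraph n → Subset n → ℚ
cutWeight {n} G X =
  sumℚ (map (λ u → sumℚ (map (λ v →
    if lookup X u ∧ not (lookup X v) then w G u v else 0ℚ) (allFin n))) (allFin n))

IsCut : ∀ {n} → Fin n → Subset n → Set
IsCut r X = Nonempty X × r ∉ X

IsMincut : ∀ {n} → WGraph n → Fin n → Subset n → Set
IsMincut G r X = IsCut r X × (∀ Y → IsCut r Y → cutWeight G X ≤ℚ cutWeight G Y)

IsMinimalMincut : ∀ {n} → WGraph n → Fin n → Fin n → Subset n → Set
IsMinimalMincut G r v Y =
  IsMincut G r Y × v ∈ Y × (∀ Z → IsMincut G r Z → v ∈ Z → ∣ Y ∣ ≤ ∣ Z ∣)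

IsParent : ∀ {n} → Fin n → (Fin n → Subset n) → Fin n → Fin n → Set
IsParent r X v p =
  ¬ (v ≡ r) × (X v ⊂ X p) × (∀ u → ¬ ((X v ⊂ X u) × (X u ⊂ X p)))

data InSubtree {n} (r : Fin n) (X : Fin n → Subset n) (v : Fin n) : Fin n → Set where
  here  : InSubtree r X v v
  below : ∀ {u p} → IsParent r X u p → InSubtree r X v p → InSubtree r X v u

{-# OPTIONS --safe #-}
-- Cut weight is submodular, so two intersecting mincuts meet in a mincut.
-- Hence the minimal mincut X_u lies inside every mincut containing u, and
-- u ∈ X_v gives X_u ⊆ X_v, strictly when u ≠ v because the X_v are distinct.
-- So u ∈ X_v iff X_u ⊆ X_v. The nesting tree is the Hasse diagram of the
-- inclusion order on {X_v}; since this order is finite, every strict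
-- inclusion X_u ⊂ X_v is a chain of covers, which makes v an ancestor of u.
module Submission where

open import Defs
open import Data.Bool using (Bool; true; false; _∧_; _∨_; not; if_then_else_; T)
open import Data.Fin using (Fin; _≟_)
open import Data.Fin.Properties using (any?)
open import Data.Fin.Subset using (Subset; _∈_; _∉_; ⊤; _∩_; _∪_; _⊆_; _⊂_; ∣_∣; Nonempty)
open import Data.Fin.Subset.Properties
  using (_∈?_; _⊂?_; ∈⊤; x∈p∩q⁺; x∈p∩q⁻; x∈p∪q⁺; x∈p∪q⁻; p∩q⊆p; p∩q⊆q; ⊆-antisym; p⊂q⇒∣p∣<∣q∣)
open import Data.List using ([]; _∷_; map; allFin)
import Data.List.Properties as ListP
open import Data.Nat using (ℕ; zero; suc; _∸_; _≤ᵇ_; z≤n; s≤s) renaming (_+_ to _+ℕ_; _≤_ to _≤ℕ_; _<_ to _<ℕ_)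
open import Data.Nat.Induction using (<-wellFounded)
import Data.Nat.Properties as ℕ
open import Data.Product using (_×_; _,_; proj₁; proj₂)
open import Data.Rational using (ℚ; 0ℚ; _+_) renaming (_≤_ to _≤ℚ_)
import Data.Rational.Properties as ℚ
open import Data.Sum using (inj₁; [_,_])
open import Function using (_∘_)
open import Data.Vec using (lookup)
open import Data.Vec.Properties using (lookup-zipWith)
open import Induction.WellFounded using (Acc; acc)
open import Relation.Binary.PropositionalEquality using (_≡_; refl; sym; trans; cong; cong₂; subst; module ≡-Reasoning)
open import Relation.Nullary using (¬_; yes; no; contradiction)
open import Relation.Nullary.Decidable using (_×-dec_)

open import Algebra.Bundles using (CommutativeMonoid)
open import Algebra.Properties.CommutativeSemigroup (CommutativeMonoid.commutativeSemigroup ℚ.+-0-commutativeMonoid)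
  using () renaming (interchange to +-interchange)
open import Algebra.Properties.Monoid.Mult ℚ.+-0-monoid using (×-homo-+) renaming (_×_ to _·_)

+-cancelʳ-≤ : ∀ c {a b} → a + c ≤ℚ b + c → a ≤ℚ b
+-cancelʳ-≤ c a+c≤b+c =
  ℚ.≮⇒≥ (λ b<a → ℚ.<-irrefl refl (ℚ.<-≤-trans (ℚ.+-monoˡ-< c b<a) a+c≤b+c))

·-nonneg : ∀ {x} → 0ℚ ≤ℚ x → ∀ n → 0ℚ ≤ℚ n · x
·-nonneg 0≤x zero    = ℚ.≤-refl
·-nonneg 0≤x (suc n) = ℚ.+-mono-≤ 0≤x (·-nonneg 0≤x n)

·-monoˡ-≤ : ∀ {x} → 0ℚ ≤ℚ x → ∀ {m n} → m ≤ℕ n → m · x ≤ℚ n · x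
·-monoˡ-≤     0≤x {n = n} z≤n = ·-nonneg 0≤x n
·-monoˡ-≤ {x} 0≤x (s≤s m≤n)   = ℚ.+-monoʳ-≤ x (·-monoˡ-≤ 0≤x m≤n)

indicator : Bool → ℚ → ℚ
indicator b x = if b then x else 0ℚ

count : Bool → ℕ
count true  = 1
count false = 0

indicator≡count· : ∀ b x → indicator b x ≡ count b · x
indicator≡count· true  x = sym (ℚ.+-identityʳ x)
indicator≡count· false x = refl

indicator-+-mono : ∀ {x} → 0ℚ ≤ℚ x → ∀ b₁ b₂ c₁ c₂ → count b₁ +ℕ count b₂ ≤ℕ count c₁ +ℕ count c₂ →
                   indicator b₁ x + indicator b₂ x ≤ℚ indicator c₁ x + indicator c₂ x
indicator-+-mono {x} 0≤x b₁ b₂ c₁ c₂ le = begin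
  indicator b₁ x + indicator b₂ x  ≡⟨ cong₂ _+_ (indicator≡count· b₁ x) (indicator≡count· b₂ x) ⟩
  count b₁ · x + count b₂ · x      ≡⟨ sym (×-homo-+ x (count b₁) (count b₂)) ⟩
  (count b₁ +ℕ count b₂) · x       ≤⟨ ·-monoˡ-≤ 0≤x le ⟩
  (count c₁ +ℕ count c₂) · x       ≡⟨ ×-homo-+ x (count c₁) (count c₂) ⟩
  count c₁ · x + count c₂ · x      ≡⟨ sym (cong₂ _+_ (indicator≡count· c₁ x) (indicator≡count· c₂ x)) ⟩
  indicator c₁ x + indicator c₂ x  ∎
  where open ℚ.≤-Reasoning

-- With a, b the memberships of u in A, B and a′, b′ those of v: the edge (u , v)
-- leaves A ∩ B and A ∪ B no more often than it leaves A and B.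
crossings-submodular : ∀ a b a′ b′ →
  T (count ((a ∧ b) ∧ not (a′ ∧ b′)) +ℕ count ((a ∨ b) ∧ not (a′ ∨ b′))
       ≤ᵇ count (a ∧ not a′) +ℕ count (b ∧ not b′))
crossings-submodular true  true  true  true  = _
crossings-submodular true  true  true  false = _
crossings-submodular true  true  false true  = _
crossings-submodular true  true  false false = _
crossings-submodular true  false true  true  = _
crossings-submodular true  false true  false = _
crossings-submodular true  false false true  = _
crossings-submodular true  false false false = _
crossings-submodular false true  true  true  = _
crossings-submodular false true  true  false = _
crossings-submodular false true  false true  = _
crossings-submodular false true  false false = _
crossings-submodular false false _     _     = _

indicator-crossings-submodular : ∀ {x} → 0ℚ ≤ℚ x → ∀ a b a′ b′ →
  indicator ((a ∧ b) ∧ not (a′ ∧ b′)) x + indicator ((a ∨ b) ∧ not (a′ ∨ b′)) x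
    ≤ℚ indicator (a ∧ not a′) x + indicator (b ∧ not b′) x
indicator-crossings-submodular 0≤x a b a′ b′ =
  indicator-+-mono 0≤x ((a ∧ b) ∧ not (a′ ∧ b′)) ((a ∨ b) ∧ not (a′ ∨ b′)) (a ∧ not a′) (b ∧ not b′)
    (ℕ.≤ᵇ⇒≤ _ _ (crossings-submodular a b a′ b′))

sumℚ-map-+ : ∀ {A : Set} (f g : A → ℚ) xs →
             sumℚ (map (λ x → f x + g x) xs) ≡ sumℚ (map f xs) + sumℚ (map g xs)
sumℚ-map-+ f g []       = sym (ℚ.+-identityʳ 0ℚ)
sumℚ-map-+ f g (x ∷ xs) =
  trans (cong ((f x + g x) +_) (sumℚ-map-+ f g xs)) (+-interchange (f x) (g x) _ _)

sumℚ-map-mono : ∀ {A : Set} {f g : A → ℚ} → (∀ x → f x ≤ℚ g x) → ∀ xs →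
                sumℚ (map f xs) ≤ℚ sumℚ (map g xs)
sumℚ-map-mono f≤g []       = ℚ.≤-refl
sumℚ-map-mono f≤g (x ∷ xs) = ℚ.+-mono-≤ (f≤g x) (sumℚ-map-mono f≤g xs)

sum² : ∀ {n} → (Fin n → Fin n → ℚ) → ℚ
sum² {n} f = sumℚ (map (λ u → sumℚ (map (f u) (allFin n))) (allFin n))

sum²-+ : ∀ {n} (f g : Fin n → Fin n → ℚ) → sum² (λ u v → f u v + g u v) ≡ sum² f + sum² g
sum²-+ {n} f g = begin
  sumℚ (map (λ u → sumℚ (map (λ v → f u v + g u v) (allFin n))) (allFin n))
    ≡⟨ cong sumℚ (ListP.map-cong (λ u → sumℚ-map-+ (f u) (g u) (allFin n)) (allFin n)) ⟩
  sumℚ (map (λ u → sumℚ (map (f u) (allFin n)) + sumℚ (map (g u) (allFin n))) (allFin n))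
    ≡⟨ sumℚ-map-+ _ _ (allFin n) ⟩
  sum² f + sum² g ∎
  where open ≡-Reasoning

sum²-mono : ∀ {n} {f g : Fin n → Fin n → ℚ} → (∀ u v → f u v ≤ℚ g u v) → sum² f ≤ℚ sum² g
sum²-mono {n} f≤g = sumℚ-map-mono (λ u → sumℚ-map-mono (f≤g u) (allFin n)) (allFin n)

crosses : ∀ {n} → WGraph n → Subset n → Fin n → Fin n → ℚ
crosses G X u v = indicator (lookup X u ∧ not (lookup X v)) (w G u v)

cutWeight-submodular : ∀ {n} (G : WGraph n) (A B : Subset n) →
                       cutWeight G (A ∩ B) + cutWeight G (A ∪ B) ≤ℚ cutWeight G A + cutWeight G B
cutWeight-submodular G A B = begin
  cutWeight G (A ∩ B) + cutWeight G (A ∪ B)                   ≡⟨ sym (sum²-+ (crosses G (A ∩ B)) _) ⟩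
  sum² (λ u v → crosses G (A ∩ B) u v + crosses G (A ∪ B) u v) ≤⟨ sum²-mono crosses-submodular ⟩
  sum² (λ u v → crosses G A u v + crosses G B u v)             ≡⟨ sum²-+ (crosses G A) _ ⟩
  cutWeight G A + cutWeight G B                               ∎
  where
  open ℚ.≤-Reasoning
  crosses-submodular : ∀ u v → crosses G (A ∩ B) u v + crosses G (A ∪ B) u v ≤ℚ crosses G A u v + crosses G B u v
  crosses-submodular u v
    rewrite lookup-zipWith _∧_ u A B | lookup-zipWith _∧_ v A B
          | lookup-zipWith _∨_ u A B | lookup-zipWith _∨_ v A B
    = indicator-crossings-submodular (w-nonneg G u v) (lookup A u) (lookup B u) (lookup A v) (lookup B v)

∪-isCut : ∀ {n} {r : Fin n} {A B} → IsCut r A → IsCut r B → IsCut r (A ∪ B)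
∪-isCut ((x , x∈A) , r∉A) (_ , r∉B) = (x , x∈p∪q⁺ (inj₁ x∈A)) , λ r∈A∪B → [ r∉A , r∉B ] (x∈p∪q⁻ _ _ r∈A∪B)

∩-isMincut : ∀ {n} {G : WGraph n} {r A B} → IsMincut G r A → IsMincut G r B →
             Nonempty (A ∩ B) → IsMincut G r (A ∩ B)
∩-isMincut {G = G} {A = A} {B} (A-cut , A-min) (B-cut , B-min) A∩B≢∅ =
  (A∩B≢∅ , λ r∈A∩B → proj₂ A-cut (proj₁ (x∈p∩q⁻ A B r∈A∩B))) ,
  λ Y Y-cut → +-cancelʳ-≤ (cutWeight G (A ∪ B)) (begin
    cutWeight G (A ∩ B) + cutWeight G (A ∪ B) ≤⟨ cutWeight-submodular G A B ⟩
    cutWeight G A + cutWeight G B           ≤⟨ ℚ.+-mono-≤ (A-min Y Y-cut) (B-min (A ∪ B) (∪-isCut A-cut B-cut)) ⟩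
    cutWeight G Y + cutWeight G (A ∪ B)     ∎)
  where open ℚ.≤-Reasoning

p⊆q⇒∣q∣≤∣p∣⇒q⊆p : ∀ {n} {p q : Subset n} → p ⊆ q → ∣ q ∣ ≤ℕ ∣ p ∣ → q ⊆ p
p⊆q⇒∣q∣≤∣p∣⇒q⊆p {p = p} p⊆q ∣q∣≤∣p∣ {x} x∈q with x ∈? p
... | yes x∈p = x∈p
... | no  x∉p = contradiction ∣q∣≤∣p∣ (ℕ.<⇒≱ (p⊂q⇒∣p∣<∣q∣ (p⊆q , x , x∈q , x∉p)))

minimalMincut-⊆ : ∀ {n} {G : WGraph n} {r u Y Z} → IsMinimalMincut G r u Y →
                  IsMincut G r Z → u ∈ Z → Y ⊆ Z
minimalMincut-⊆ {G = G} {Y = Y} {Z} (Y-mincut , u∈Y , Y-least) Z-mincut u∈Z =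
  λ x∈Y → p∩q⊆q Y Z (Y⊆Y∩Z x∈Y)
  where
  u∈Y∩Z = x∈p∩q⁺ (u∈Y , u∈Z)
  Y⊆Y∩Z = p⊆q⇒∣q∣≤∣p∣⇒q⊆p (p∩q⊆p Y Z) (Y-least (Y ∩ Z) (∩-isMincut {G = G} Y-mincut Z-mincut (_ , u∈Y∩Z)) u∈Y∩Z)

InSubtree-trans : ∀ {n} {r : Fin n} {X u v w} → InSubtree r X w v → InSubtree r X v u → InSubtree r X w u
InSubtree-trans w⇝v here           = w⇝v
InSubtree-trans w⇝v (below u→p p⇝) = below u→p (InSubtree-trans w⇝v p⇝)

InSubtree⇒⊆ : ∀ {n} {r : Fin n} {X u v} → InSubtree r X v u → X u ⊆ X v
InSubtree⇒⊆ here                         = λ x∈ → x∈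
InSubtree⇒⊆ (below (_ , (u⊆p , _) , _) p⇝) = λ x∈ → InSubtree⇒⊆ p⇝ (u⊆p x∈)

module MinimalMincuts {n} (G : WGraph n) (r : Fin n) (X : Fin n → Subset n)
  (X-root : X r ≡ ⊤)
  (X-minimal : ∀ v → ¬ (v ≡ r) → IsMinimalMincut G r v (X v))
  (X-injective : ∀ u v → ¬ (u ≡ r) → ¬ (v ≡ r) → X u ≡ X v → u ≡ v)
  where

  ∈X-root : ∀ {x} → x ∈ X r
  ∈X-root = subst (_ ∈_) (sym X-root) ∈⊤

  ∈X-self : ∀ v → v ∈ X v
  ∈X-self v with v ≟ r
  ... | yes refl = ∈X-root
  ... | no  v≢r  = proj₁ (proj₂ (X-minimal v v≢r))

  r∉X : ∀ {v} → ¬ (v ≡ r) → r ∉ X v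
  r∉X v≢r = proj₂ (proj₁ (proj₁ (X-minimal _ v≢r)))

  ⊂X⇒≢r : ∀ {u v} → X u ⊂ X v → ¬ (u ≡ r)
  ⊂X⇒≢r (_ , _ , _ , x∉Xr) refl = x∉Xr ∈X-root

  ∈X⇒⊆ : ∀ {u v} → ¬ (u ≡ r) → u ∈ X v → X u ⊆ X v
  ∈X⇒⊆ {u} {v} u≢r u∈Xv with v ≟ r
  ... | yes refl = λ _ → ∈X-root
  ... | no  v≢r  = minimalMincut-⊆ {G = G} (X-minimal u u≢r) (proj₁ (X-minimal v v≢r)) u∈Xv

  ∈X⇒⊂ : ∀ {u v} → ¬ (u ≡ r) → ¬ (u ≡ v) → u ∈ X v → X u ⊂ X v
  ∈X⇒⊂ {u} {v} u≢r u≢v u∈Xv with v ≟ r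
  ... | yes refl = ∈X⇒⊆ u≢r u∈Xv , r , ∈X-self r , r∉X u≢r
  ... | no  v≢r  = ∈X⇒⊆ u≢r u∈Xv , v , ∈X-self v ,
                   λ v∈Xu → u≢v (X-injective u v u≢r v≢r (⊆-antisym (∈X⇒⊆ u≢r u∈Xv) (∈X⇒⊆ v≢r v∈Xu)))

  -- Split X u ⊂ X w at an intermediate X c when there is one, otherwise w is
  -- the parent of u; the size gap ∣ X w ∣ ∸ ∣ X u ∣ decreases in both halves.
  ⊂⇒InSubtree : ∀ {u w} → X u ⊂ X w → InSubtree r X w u
  ⊂⇒InSubtree u⊂w = go (<-wellFounded _) u⊂w
    where
    go : ∀ {u w} → Acc _<ℕ_ (∣ X w ∣ ∸ ∣ X u ∣) → X u ⊂ X w → InSubtree r X w u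
    go {u} {w} (acc smaller) u⊂w with any? (λ c → (X u ⊂? X c) ×-dec (X c ⊂? X w))
    ... | no  ∄c               = below (⊂X⇒≢r u⊂w , u⊂w , λ c between → ∄c (c , between)) here
    ... | yes (c , u⊂c , c⊂w) = InSubtree-trans
      (go (smaller (ℕ.∸-monoʳ-< (p⊂q⇒∣p∣<∣q∣ u⊂c) (ℕ.<⇒≤ (p⊂q⇒∣p∣<∣q∣ c⊂w)))) c⊂w)
      (go (smaller (ℕ.∸-monoˡ-< (p⊂q⇒∣p∣<∣q∣ c⊂w) (ℕ.<⇒≤ (p⊂q⇒∣p∣<∣q∣ u⊂c)))) u⊂c)

  ∈X⇒InSubtree : ∀ {u v} → u ∈ X v → InSubtree r X v u
  ∈X⇒InSubtree {u} {v} u∈Xv with u ≟ v | u ≟ r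
  ... | yes refl | _        = here
  ... | no  u≢v  | no  u≢r  = ⊂⇒InSubtree (∈X⇒⊂ u≢r u≢v u∈Xv)
  ... | no  r≢v  | yes refl = contradiction u∈Xv (r∉X (r≢v ∘ sym))

lemmaA2 : ∀ {n} (G : WGraph n) (r : Fin n) (X : Fin n → Subset n)
          → X r ≡ ⊤
          → (∀ v → ¬ (v ≡ r) → IsMinimalMincut G r v (X v))
          → (∀ u v → ¬ (u ≡ r) → ¬ (v ≡ r) → X u ≡ X v → u ≡ v)
          → ∀ v u → (u ∈ X v → InSubtree r X v u) × (InSubtree r X v u → u ∈ X v)
lemmaA2 G r X X-root X-minimal X-injective v u =
  ∈X⇒InSubtree , λ v⇝u → InSubtree⇒⊆ v⇝u (∈X-self u)
  where open MinimalMincuts G r X X-root X-minimal X-injective
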